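{- Let $k\geq 7$ and $i$ be integers with $2\leq i\leq \lfloor (k-1)/2\rfloor$. Let $H\subseteq[n]$ and let $\mathcal{A}=\mathcal{A}^{\mathrm{small}}\cup\mathcal{A}^{\mathrm{large}}\subseteq\mathcal{P}([n])$ be a saturated antichain with homogeneous atom $H$. Suppose that: - $|S|\geq i$ for all $S\in\mathcal{A}^{\mathrm{small}}$; - $|L|\leq n-(k-i-1)$ for all $L\in\mathcal{A}^{\mathrm{large}}$. Then $$|\mathcal{A}^{\mathrm{small}}|+|\mathcal{A}^{\mathrm{large}}| > \exp\left\{2\ln 2\,\frac{i(k-i-1)}{k-1}\right\}.$$
   Context: An antichain $\mathcal{A}\subseteq\mathcal{P}([n])$ is a family with no two distinct members related by inclusion. It is saturated if, for every $S\in\mathcal{P}([n])\setminus\mathcal{A}$, the family $\mathcal{A}\cup\{S\}$ is not an antichain. An atom of $\mathcal{A}$ is a set $A$ maximal with respect to $S\cap A\in\{\emptyset,A\}$ for all $S\in\mathcal{A}$. It is homogeneous if $|A|\ge 2$. $\mathcal{A}^{\mathrm{small}}$ denotes the members of $\mathcal{A}$ disjoint from $H$, and $\mathcal{A}^{\mathrm{large}}$ the members containing $H$. Every member of $\mathcal{A}$ is of one of these two types. -}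

module Defs where

open import Data.Nat using (ℕ)
open import Data.Fin.Subset using (Subset; _⊆_; _∩_; ⊥)
open import Data.List using (List)
open import Data.List.Membership.Propositional using (_∈_; _∉_)
open import Data.List.Relation.Unary.Unique.Propositional using (Unique)
open import Data.Sum using (_⊎_)
open import Data.Product using (Σ; _×_)
open import Relation.Binary.PropositionalEquality using (_≡_)

-- A family of subsets of [n] = Fin n, given as a duplicate-free list.
Family : ℕ → Set
Family n = List (Subset n)

IsAntichain : ∀ {n} → Family n → Set
IsAntichain {n} 𝒜 = ∀ {S T : Subset n} → S ∈ 𝒜 → T ∈ 𝒜 → S ⊆ T → S ≡ T

IsSaturated : ∀ {n} → Family n → Set
IsSaturated {n} 𝒜 =
  ∀ (S : Subset n) → S ∉ 𝒜 → Σ (Subset n) λ T → T ∈ 𝒜 × (T ⊆ S ⊎ S ⊆ T)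

SaturatedAntichain : ∀ {n} → Family n → Set
SaturatedAntichain 𝒜 = Unique 𝒜 × IsAntichain 𝒜 × IsSaturated 𝒜

Splits : ∀ {n} → Family n → Subset n → Set
Splits 𝒜 X = ∀ {S} → S ∈ 𝒜 → (S ∩ X ≡ ⊥) ⊎ (S ∩ X ≡ X)

IsAtom : ∀ {n} → Family n → Subset n → Set
IsAtom {n} 𝒜 X = Splits 𝒜 X × (∀ (Y : Subset n) → X ⊆ Y → Splits 𝒜 Y → Y ≡ X)

-- A weighted LYM argument. Weight T ⊆ [n] by u ^ ∣ T ∣ * v ^ (n - ∣ T ∣), so that all subsets
-- together weigh (u + v) ^ n. Call a member small if it is disjoint from the atom H and large if
-- it contains H. Every T lies above a small member or below a large one: pick x ∈ H; since
-- ∣ H ∣ ≥ 2, the set (T ∖ H) ∪ {x} is not a member, and the member that saturation makes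
-- comparable with it does the job. Hence the up-sets of the small members and the down-sets of
-- the large ones weigh at least (u + v) ^ n in total, and strictly more once ∣ 𝒜 ∣ ≥ 3, since
-- then ⊤ or ⊥ is caught twice. The up-set of S weighs u ^ ∣ S ∣ * (u + v) ^ (n - ∣ S ∣), the
-- down-set of L weighs (u + v) ^ ∣ L ∣ * v ^ (n - ∣ L ∣). If ∣ 𝒜 ∣ ^ (i + j) ≤ 4 ^ (i * j), natural
-- weights u, v make each of these at most (u + v) ^ n / ∣ 𝒜 ∣, a contradiction; u = v = 1
-- with i = j = 2 shows ∣ 𝒜 ∣ ≥ 4 in the first place.

module Submission where

open import Defs
open import Data.Bool using (Bool; true; false)
open import Data.Empty using (⊥-elim)
open import Data.Fin using (zero; suc)
open import Data.Fin.Subset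
  using (Subset; inside; outside; _⊆_; _∩_; _∪_; ∁; ⁅_⁆; ∣_∣; ⊥; ⊤; Nonempty)
  renaming (_∈_ to _∈ₛ_; _∉_ to _∉ₛ_)
open import Data.Fin.Subset.Properties
  using (_⊆?_; _∈?_; ⊆-min; ⊆-max; ∉⊥; x∈p∩q⁺; x∈p∩q⁻; p∩q⊆p; x∈p∪q⁺; x∈p∪q⁻; x∈⁅x⁆;
         x∈⁅y⁆⇒x≡y; ∣⁅x⁆∣≡1; p⊆q⇒∣p∣≤∣q∣; ∣∁p∣≡n∸∣p∣; x∈∁p⇒x∉p; x∉p⇒x∈∁p)
open import Data.List using ([]; _∷_; map; length)
open import Data.List.Membership.Propositional using (_∈_; _∉_)
open import Data.List.Relation.Unary.Any using (here; there)
open import Data.Nat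
open import Data.Nat.DivMod using (m/n*n≤m)
open import Data.Nat.ListAction using (sum)
open import Data.Nat.Properties
open import Data.Nat.Solver using (module +-*-Solver)
open import Data.Product using (∃-syntax; _×_; _,_)
open import Data.Sum using (_⊎_; inj₁; inj₂)
open import Data.Vec using ([]; _∷_) renaming (here to hereᵥ; there to thereᵥ)
open import Function using (_∘_)
open import Level using (0ℓ)
open import Relation.Binary.PropositionalEquality
open import Relation.Nullary using (Dec; yes; no; does; ¬_; contradiction)
open import Relation.Nullary.Decidable using (dec-true)
open import Relation.Unary using (Pred; Decidable)

open +-*-Solver using (solve; _:+_; _:*_; _:=_; con)

open import Algebra.Properties.CommutativeSemigroup *-commutativeSemigroup
  using () renaming (interchange to *-interchange)
open import Algebra.Properties.CommutativeSemigroup +-commutativeSemigroup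
  using () renaming (interchange to +-interchange)

-- Arithmetic

^-distribʳ-* : ∀ m n o → (m * n) ^ o ≡ m ^ o * n ^ o
^-distribʳ-* m n zero    = refl
^-distribʳ-* m n (suc o) = begin
  m * n * (m * n) ^ o      ≡⟨ cong (m * n *_) (^-distribʳ-* m n o) ⟩
  m * n * (m ^ o * n ^ o)  ≡⟨ *-interchange m n (m ^ o) (n ^ o) ⟩
  m ^ suc o * n ^ suc o    ∎
  where open ≡-Reasoning

^-exchange : ∀ m n o → (m ^ n) ^ o ≡ (m ^ o) ^ n
^-exchange m n o = begin
  (m ^ n) ^ o  ≡⟨ ^-*-assoc m n o ⟩
  m ^ (n * o)  ≡⟨ cong (m ^_) (*-comm n o) ⟩
  m ^ (o * n)  ≡⟨ ^-*-assoc m o n ⟨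
  (m ^ o) ^ n  ∎
  where open ≡-Reasoning

^-cancelˡ-≤ : ∀ o .{{_ : NonZero o}} {m n} → m ^ o ≤ n ^ o → m ≤ n
^-cancelˡ-≤ o {m} {n} mᵒ≤nᵒ with m ≤? n
... | yes m≤n = m≤n
... | no  m≰n = contradiction mᵒ≤nᵒ (<⇒≱ (^-monoˡ-< o (≰⇒> m≰n)))

c*u^a≤w^a⇒c*u^b≤w^b : ∀ c {u w a b} → u ≤ w → a ≤ b → c * u ^ a ≤ w ^ a → c * u ^ b ≤ w ^ b
c*u^a≤w^a⇒c*u^b≤w^b c {u} {w} {a} {b} u≤w a≤b cuᵃ≤wᵃ with m≤n⇒∃[o]m+o≡n a≤b
... | d , refl = begin
  c * u ^ (a + d)      ≡⟨ cong (c *_) (^-distribˡ-+-* u a d) ⟩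
  c * (u ^ a * u ^ d)  ≡⟨ *-assoc c (u ^ a) (u ^ d) ⟨
  c * u ^ a * u ^ d    ≤⟨ *-mono-≤ cuᵃ≤wᵃ (^-monoˡ-≤ d u≤w) ⟩
  w ^ a * w ^ d        ≡⟨ ^-distribˡ-+-* w a d ⟨
  w ^ (a + d)          ∎
  where open ≤-Reasoning

3≤m+n⇒2≤m⊎2≤n : ∀ m n → 3 ≤ m + n → 2 ≤ m ⊎ 2 ≤ n
3≤m+n⇒2≤m⊎2≤n zero                n 3≤n       = inj₂ (≤-trans (n≤1+n 2) 3≤n)
3≤m+n⇒2≤m⊎2≤n (suc zero)          n (s≤s 2≤n) = inj₂ 2≤n
3≤m+n⇒2≤m⊎2≤n (suc (suc m))       n _         = inj₁ (s≤s (s≤s z≤n))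

i≤[k∸1]/2⇒i+i≤k∸1 : ∀ k {i} → i ≤ (k ∸ 1) / 2 → i + i ≤ k ∸ 1
i≤[k∸1]/2⇒i+i≤k∸1 k {i} i≤[k∸1]/2 = begin
  i + i            ≡⟨ cong (i +_) (+-identityʳ i) ⟨
  2 * i            ≡⟨ *-comm 2 i ⟩
  i * 2            ≤⟨ *-monoˡ-≤ 2 i≤[k∸1]/2 ⟩
  (k ∸ 1) / 2 * 2  ≤⟨ m/n*n≤m (k ∸ 1) 2 ⟩
  k ∸ 1            ∎
  where open ≤-Reasoning

k∸i∸1≡k∸1∸i : ∀ k i → k ∸ i ∸ 1 ≡ k ∸ 1 ∸ i
k∸i∸1≡k∸1∸i k i = trans (∸-+-assoc k i 1) (trans (cong (k ∸_) (+-comm i 1)) (sym (∸-+-assoc k 1 i)))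

i+i≤k∸1⇒i≤k∸i∸1 : ∀ k {i} → i + i ≤ k ∸ 1 → i ≤ k ∸ i ∸ 1
i+i≤k∸1⇒i≤k∸i∸1 k {i} i+i≤k∸1 = subst (i ≤_) (sym (k∸i∸1≡k∸1∸i k i)) (m+n≤o⇒m≤o∸n i i+i≤k∸1)

i≤k∸1⇒i+[k∸i∸1]≡k∸1 : ∀ k {i} → i ≤ k ∸ 1 → i + (k ∸ i ∸ 1) ≡ k ∸ 1
i≤k∸1⇒i+[k∸i∸1]≡k∸1 k {i} i≤k∸1 = trans (cong (i +_) (k∸i∸1≡k∸1∸i k i)) (m+[n∸m]≡n i≤k∸1)

-- For z = y - s m this is (1 + m / y) ^ s ≤ 1 / (1 - s m / y), cleared of denominators.
z+s*m≤y⇒[y+m]^s*z≤y^s*y : ∀ s {y m z} → z + s * m ≤ y → (y + m) ^ s * z ≤ y ^ s * y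
z+s*m≤y⇒[y+m]^s*z≤y^s*y zero    {y} z+0≤y = ≤-trans z+0≤y (m≤m+n y 0)
z+s*m≤y⇒[y+m]^s*z≤y^s*y (suc s) {y} {m} {z} z+[1+s]*m≤y = begin
  (y + m) * (y + m) ^ s * z    ≡⟨ solve 3 (λ a b c → a :* b :* c := b :* (a :* c)) refl (y + m) ((y + m) ^ s) z ⟩
  (y + m) ^ s * ((y + m) * z)  ≤⟨ *-monoʳ-≤ ((y + m) ^ s) [y+m]z≤y[z+m] ⟩
  (y + m) ^ s * (y * (z + m))  ≡⟨ solve 3 (λ a b c → a :* (b :* c) := b :* (a :* c)) refl ((y + m) ^ s) y (z + m) ⟩
  y * ((y + m) ^ s * (z + m))  ≤⟨ *-monoʳ-≤ y (z+s*m≤y⇒[y+m]^s*z≤y^s*y s z+m+s*m≤y) ⟩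
  y * (y ^ s * y)              ≡⟨ *-assoc y (y ^ s) y ⟨
  y * y ^ s * y                ∎
  where
  open ≤-Reasoning
  z+m+s*m≤y : z + m + s * m ≤ y
  z+m+s*m≤y = ≤-trans (≤-reflexive (+-assoc z m (s * m))) z+[1+s]*m≤y
  [y+m]z≤y[z+m] : (y + m) * z ≤ y * (z + m)
  [y+m]z≤y[z+m] = begin
    (y + m) * z    ≡⟨ solve 3 (λ y m z → (y :+ m) :* z := y :* z :+ z :* m) refl y m z ⟩
    y * z + z * m  ≤⟨ +-monoʳ-≤ (y * z) (*-monoˡ-≤ m (m+n≤o⇒m≤o z z+[1+s]*m≤y)) ⟩
    y * z + y * m  ≡⟨ *-distribˡ-+ y z m ⟨
    y * (z + m)    ∎

2*y^s≤[y+m]^s⇒y≤2*[s*m] : ∀ s y m → 2 * y ^ s ≤ (y + m) ^ s → y ≤ 2 * (s * m)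
2*y^s≤[y+m]^s⇒y≤2*[s*m] s zero        m _ = z≤n
2*y^s≤[y+m]^s⇒y≤2*[s*m] s y@(suc _) m 2yˢ≤[y+m]ˢ with ≤-total y (s * m)
... | inj₁ y≤sm = ≤-trans y≤sm (m≤m+n (s * m) _)
... | inj₂ sm≤y with m≤n⇒∃[o]m+o≡n sm≤y
...   | z , sm+z≡y = begin
  y              ≡⟨ sm+z≡y ⟨
  s * m + z      ≤⟨ +-monoʳ-≤ (s * m) (≤-trans z≤sm (m≤m+n (s * m) 0)) ⟩
  2 * (s * m)    ∎
  where
  open ≤-Reasoning
  instance
    yˢ≢0 : NonZero (y ^ s)
    yˢ≢0 = m^n≢0 y s
  z+z≤y : z + z ≤ y
  z+z≤y = *-cancelˡ-≤ (y ^ s) (begin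
    y ^ s * (z + z)    ≡⟨ solve 2 (λ a z → a :* (z :+ z) := con 2 :* a :* z) refl (y ^ s) z ⟩
    2 * y ^ s * z      ≤⟨ *-monoˡ-≤ z 2yˢ≤[y+m]ˢ ⟩
    (y + m) ^ s * z    ≤⟨ z+s*m≤y⇒[y+m]^s*z≤y^s*y s (≤-reflexive (trans (+-comm z (s * m)) sm+z≡y)) ⟩
    y ^ s * y          ∎)
  z≤sm : z ≤ s * m
  z≤sm = +-cancelʳ-≤ z z (s * m) (≤-trans z+z≤y (≤-reflexive (sym sm+z≡y)))

2*y^s≤[y+m]^s⇒2*y+4*m≤m*m : ∀ s y m → 2 * y ^ s ≤ (y + m) ^ s →
  (1 + 2 * s) * (4 + 4 * s) ≤ y + m → 2 * y + 4 * m ≤ m * m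
2*y^s≤[y+m]^s⇒2*y+4*m≤m*m s y m 2yˢ≤[y+m]ˢ big = begin
  2 * y + 4 * m               ≤⟨ +-monoˡ-≤ (4 * m) (*-monoʳ-≤ 2 y≤2sm) ⟩
  2 * (2 * (s * m)) + 4 * m   ≡⟨ solve 2 (λ s m → con 2 :* (con 2 :* (s :* m)) :+ con 4 :* m
                                                  := (con 4 :+ con 4 :* s) :* m) refl s m ⟩
  (4 + 4 * s) * m             ≤⟨ *-monoˡ-≤ m 4+4s≤m ⟩
  m * m                       ∎
  where
  open ≤-Reasoning
  y≤2sm : y ≤ 2 * (s * m)
  y≤2sm = 2*y^s≤[y+m]^s⇒y≤2*[s*m] s y m 2yˢ≤[y+m]ˢ
  4+4s≤m : 4 + 4 * s ≤ m
  4+4s≤m = *-cancelˡ-≤ (1 + 2 * s) (begin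
    (1 + 2 * s) * (4 + 4 * s)  ≤⟨ big ⟩
    y + m                      ≤⟨ +-monoˡ-≤ m y≤2sm ⟩
    2 * (s * m) + m            ≡⟨ solve 2 (λ s m → con 2 :* (s :* m) :+ m
                                                 := (con 1 :+ con 2 :* s) :* m) refl s m ⟩
    (1 + 2 * s) * m            ∎)

complementary-^-< : ∀ q i j {v x W} .{{_ : NonZero W}} → q * (v * x) ≤ W * W →
  W ^ (i + j) < q ^ j * x ^ (i + j) → q ^ i * v ^ (i + j) < W ^ (i + j)
complementary-^-< q i j {v} {x} {W} qvx≤W² Wˢ<B = *-cancelʳ-< B _ _ (begin-strict
  q ^ i * v ^ s * B                 ≡⟨ *-interchange (q ^ i) (v ^ s) (q ^ j) (x ^ s) ⟩
  q ^ i * q ^ j * (v ^ s * x ^ s)   ≡⟨ cong₂ _*_ (^-distribˡ-+-* q i j) (^-distribʳ-* v x s) ⟨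
  q ^ s * (v * x) ^ s               ≡⟨ ^-distribʳ-* q (v * x) s ⟨
  (q * (v * x)) ^ s                 ≤⟨ ^-monoˡ-≤ s qvx≤W² ⟩
  (W * W) ^ s                       ≡⟨ ^-distribʳ-* W W s ⟩
  W ^ s * W ^ s                     <⟨ *-monoʳ-< (W ^ s) {{m^n≢0 W s}} Wˢ<B ⟩
  W ^ s * B                         ∎)
  where
  open ≤-Reasoning
  s B : ℕ
  s = i + j
  B = q ^ j * x ^ s

last-true-before : ∀ {p} {P : Pred ℕ p} → Decidable P →
  ∀ {a} d → P a → ¬ P (a + d) → ∃[ u ] a ≤ u × P u × ¬ P (suc u)
last-true-before {P = P} P? {a} zero Pa ¬Pa+0 = contradiction (subst P (sym (+-identityʳ a)) Pa) ¬Pa+0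
last-true-before {P = P} P? {a} (suc d) Pa ¬Pa+1+d with P? (suc a)
... | no ¬P1+a = a , ≤-refl , Pa , ¬P1+a
... | yes P1+a with last-true-before P? d P1+a (¬Pa+1+d ∘ subst P (sym (+-suc a d)))
...   | u , 1+a≤u , Pu , ¬P1+u = u , <⇒≤ 1+a≤u , Pu , ¬P1+u

-- With v = W - u and p = u / W the goal reads p ^ s ≤ 4 ^ -j and (1 - p) ^ s ≤ 4 ^ -i; over the
-- reals such p exists since 4 ^ (-j/s) + 4 ^ (-i/s) ≥ 1 by AM-GM, strictly if i < j. We take u
-- maximal with 4 ^ j * u ^ s ≤ W ^ s; W = (1 + 2 s)(4 + 4 s) is large enough that this rounding
-- costs nothing.
module _ {i j} (1≤i : 1 ≤ i) (i<j : i < j) where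

  private
    s W : ℕ
    s = i + j
    W = (1 + 2 * s) * (4 + 4 * s)

    instance
      s≢0 : NonZero s
      s≢0 = >-nonZero (≤-trans 1≤i (m≤m+n i j))

    Fits : Pred ℕ 0ℓ
    Fits u = 4 ^ j * u ^ s ≤ W ^ s

    fits-1 : Fits 1
    fits-1 = begin
      4 ^ j * 1 ^ s  ≡⟨ trans (cong (4 ^ j *_) (^-zeroˡ s)) (*-identityʳ (4 ^ j)) ⟩
      4 ^ j          ≤⟨ ^-monoʳ-≤ 4 (m≤n+m j i) ⟩
      4 ^ s          ≤⟨ ^-monoˡ-≤ s (s≤s (s≤s (s≤s (s≤s z≤n)))) ⟩
      W ^ s          ∎
      where open ≤-Reasoning

    ¬fits-W : ¬ Fits W
    ¬fits-W = <⇒≱ (begin-strict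
      W ^ s          ≡⟨ *-identityˡ (W ^ s) ⟨
      1 * W ^ s      <⟨ *-monoˡ-< (W ^ s) {{m^n≢0 W s}} (^-monoʳ-< 4 (s≤s (s≤s z≤n)) (≤-trans (s≤s z≤n) i<j)) ⟩
      4 ^ j * W ^ s  ∎)
      where open ≤-Reasoning

    fits⇒2*[2u]^s≤W^s : ∀ {u} → Fits u → 2 * (2 * u) ^ s ≤ W ^ s
    fits⇒2*[2u]^s≤W^s {u} fits = begin
      2 * (2 * u) ^ s        ≡⟨ cong (2 *_) (^-distribʳ-* 2 u s) ⟩
      2 * (2 ^ s * u ^ s)    ≡⟨ *-assoc 2 (2 ^ s) (u ^ s) ⟨
      2 ^ suc s * u ^ s      ≤⟨ *-monoˡ-≤ (u ^ s) (^-monoʳ-≤ 2 1+s≤2j) ⟩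
      2 ^ (2 * j) * u ^ s    ≡⟨ cong (_* u ^ s) (^-*-assoc 2 2 j) ⟨
      4 ^ j * u ^ s          ≤⟨ fits ⟩
      W ^ s                  ∎
      where
      open ≤-Reasoning
      1+s≤2j : suc s ≤ 2 * j
      1+s≤2j = ≤-trans (+-monoˡ-≤ j i<j) (≤-reflexive (cong (j +_) (sym (+-identityʳ j))))

    fits⇒2u≤W : ∀ {u} → Fits u → 2 * u ≤ W
    fits⇒2u≤W fits = ^-cancelˡ-≤ s (≤-trans (m≤m+n _ _) (fits⇒2*[2u]^s≤W^s fits))

    complement-fits : ∀ {u m} → Fits u → ¬ Fits (suc u) → 2 * u + m ≡ W → 4 ^ i * (u + m) ^ s ≤ W ^ s
    complement-fits {u} {m} fits ¬fits 2u+m≡W =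
      <⇒≤ (complementary-^-< 4 i j 4[u+m][1+u]≤W² (≰⇒> ¬fits))
      where
      gap : 2 * (2 * u) + 4 * m ≤ m * m
      gap = 2*y^s≤[y+m]^s⇒2*y+4*m≤m*m s (2 * u) m
        (subst (λ x → 2 * (2 * u) ^ s ≤ x ^ s) (sym 2u+m≡W) (fits⇒2*[2u]^s≤W^s fits))
        (≤-reflexive (sym 2u+m≡W))
      4[u+m][1+u]≤W² : 4 * ((u + m) * suc u) ≤ W * W
      4[u+m][1+u]≤W² = subst (λ x → 4 * ((u + m) * suc u) ≤ x * x) 2u+m≡W
        (+-cancelʳ-≤ (m * m) _ _ (begin
          4 * ((u + m) * suc u) + m * m
            ≡⟨ solve 2 (λ u m → con 4 :* ((u :+ m) :* (con 1 :+ u)) :+ m :* m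
                             := (con 2 :* u :+ m) :* (con 2 :* u :+ m) :+ (con 2 :* (con 2 :* u) :+ con 4 :* m))
                       refl u m ⟩
          (2 * u + m) * (2 * u + m) + (2 * (2 * u) + 4 * m)
            ≤⟨ +-monoʳ-≤ _ gap ⟩
          (2 * u + m) * (2 * u + m) + m * m
            ∎))
        where open ≤-Reasoning

  balanced-weights-< : ∃[ u ] ∃[ v ] 1 ≤ u × 1 ≤ v ×
    4 ^ j * u ^ (i + j) ≤ (u + v) ^ (i + j) × 4 ^ i * v ^ (i + j) ≤ (u + v) ^ (i + j)
  balanced-weights-< with last-true-before (λ u → 4 ^ j * u ^ s ≤? W ^ s) (W ∸ 1) fits-1 ¬fits-W
  ... | u , 1≤u , fits , ¬fits with m≤n⇒∃[o]m+o≡n (fits⇒2u≤W fits)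
  ...   | m , 2u+m≡W = u , u + m , 1≤u , ≤-trans 1≤u (m≤m+n u m) ,
    subst (λ x → 4 ^ j * u ^ s ≤ x ^ s) (sym u+v≡W) fits ,
    subst (λ x → 4 ^ i * (u + m) ^ s ≤ x ^ s) (sym u+v≡W) (complement-fits fits ¬fits 2u+m≡W)
    where
    u+v≡W : u + (u + m) ≡ W
    u+v≡W = trans (solve 2 (λ u m → u :+ (u :+ m) := con 2 :* u :+ m) refl u m) 2u+m≡W

balanced-weights : ∀ {i j} → 1 ≤ i → i ≤ j → ∃[ u ] ∃[ v ] 1 ≤ u × 1 ≤ v ×
  4 ^ j * u ^ (i + j) ≤ (u + v) ^ (i + j) × 4 ^ i * v ^ (i + j) ≤ (u + v) ^ (i + j)
balanced-weights {i} 1≤i i≤j with m≤n⇒m<n∨m≡n i≤j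
... | inj₁ i<j  = balanced-weights-< 1≤i i<j
... | inj₂ refl = 1 , 1 , ≤-refl , ≤-refl , halves , halves
  where
  halves : 4 ^ i * 1 ^ (i + i) ≤ 2 ^ (i + i)
  halves = ≤-reflexive (begin
    4 ^ i * 1 ^ (i + i)  ≡⟨ trans (cong (4 ^ i *_) (^-zeroˡ (i + i))) (*-identityʳ (4 ^ i)) ⟩
    4 ^ i                ≡⟨ ^-*-assoc 2 2 i ⟩
    2 ^ (2 * i)          ≡⟨ cong (λ k → 2 ^ (i + k)) (+-identityʳ i) ⟩
    2 ^ (i + i)          ∎)
    where open ≡-Reasoning

N^[a+b]≤q^[a*b]⇒N*u^a≤w^a : ∀ a b {N q u w} .{{_ : NonZero (a + b)}} → N ^ (a + b) ≤ q ^ (a * b) →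
  q ^ b * u ^ (a + b) ≤ w ^ (a + b) → N * u ^ a ≤ w ^ a
N^[a+b]≤q^[a*b]⇒N*u^a≤w^a a b {N} {q} {u} {w} Nˢ≤qᵃᵇ qᵇuˢ≤wˢ = ^-cancelˡ-≤ s (begin
  (N * u ^ a) ^ s            ≡⟨ ^-distribʳ-* N (u ^ a) s ⟩
  N ^ s * (u ^ a) ^ s        ≡⟨ cong (N ^ s *_) (^-exchange u a s) ⟩
  N ^ s * (u ^ s) ^ a        ≤⟨ *-monoˡ-≤ ((u ^ s) ^ a) Nˢ≤qᵃᵇ ⟩
  q ^ (a * b) * (u ^ s) ^ a  ≡⟨ cong (λ k → q ^ k * (u ^ s) ^ a) (*-comm a b) ⟩
  q ^ (b * a) * (u ^ s) ^ a  ≡⟨ cong (_* (u ^ s) ^ a) (^-*-assoc q b a) ⟨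
  (q ^ b) ^ a * (u ^ s) ^ a  ≡⟨ ^-distribʳ-* (q ^ b) (u ^ s) a ⟨
  (q ^ b * u ^ s) ^ a        ≤⟨ ^-monoˡ-≤ a qᵇuˢ≤wˢ ⟩
  (w ^ s) ^ a                ≡⟨ ^-exchange w s a ⟩
  (w ^ a) ^ s                ∎)
  where
  open ≤-Reasoning
  s : ℕ
  s = a + b

admissible-weights : ∀ {i j N} → 1 ≤ i → i ≤ j → N ^ (i + j) ≤ 4 ^ (i * j) →
  ∃[ u ] ∃[ v ] 1 ≤ u × 1 ≤ v × N * u ^ i ≤ (u + v) ^ i × N * v ^ j ≤ (u + v) ^ j
admissible-weights {i} {j} {N} 1≤i i≤j Nˢ≤4ⁱʲ with balanced-weights 1≤i i≤j
... | u , v , 1≤u , 1≤v , 4ʲuˢ≤wˢ , 4ⁱvˢ≤wˢ = u , v , 1≤u , 1≤v ,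
  N^[a+b]≤q^[a*b]⇒N*u^a≤w^a i j Nˢ≤4ⁱʲ 4ʲuˢ≤wˢ ,
  N^[a+b]≤q^[a*b]⇒N*u^a≤w^a j i (subst₂ (λ s t → N ^ s ≤ 4 ^ t) (+-comm i j) (*-comm i j) Nˢ≤4ⁱʲ)
    (subst (λ s → 4 ^ i * v ^ s ≤ (u + v) ^ s) (+-comm i j) 4ⁱvˢ≤wˢ)
  where
  instance
    i+j≢0 : NonZero (i + j)
    i+j≢0 = >-nonZero (≤-trans 1≤i (m≤m+n i j))
    j+i≢0 : NonZero (j + i)
    j+i≢0 = >-nonZero (≤-trans 1≤i (m≤n+m i j))

-- Weighted sums over all subsets

∑ : ∀ {n} → (Subset n → ℕ) → ℕ
∑ {zero}  f = f []
∑ {suc n} f = ∑ (λ T → f (inside ∷ T)) + ∑ (λ T → f (outside ∷ T))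

∑-cong : ∀ {n} {f g : Subset n → ℕ} → (∀ T → f T ≡ g T) → ∑ f ≡ ∑ g
∑-cong {zero}  f≗g = f≗g []
∑-cong {suc n} f≗g = cong₂ _+_ (∑-cong (f≗g ∘ (inside ∷_))) (∑-cong (f≗g ∘ (outside ∷_)))

∑-+ : ∀ {n} (f g : Subset n → ℕ) → ∑ (λ T → f T + g T) ≡ ∑ f + ∑ g
∑-+ {zero}  f g = refl
∑-+ {suc n} f g = begin
  ∑ (λ T → f (inside ∷ T) + g (inside ∷ T)) + ∑ (λ T → f (outside ∷ T) + g (outside ∷ T))
    ≡⟨ cong₂ _+_ (∑-+ (f ∘ (inside ∷_)) (g ∘ (inside ∷_))) (∑-+ (f ∘ (outside ∷_)) (g ∘ (outside ∷_))) ⟩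
  (∑ (f ∘ (inside ∷_)) + ∑ (g ∘ (inside ∷_))) + (∑ (f ∘ (outside ∷_)) + ∑ (g ∘ (outside ∷_)))
    ≡⟨ +-interchange (∑ (f ∘ (inside ∷_))) _ (∑ (f ∘ (outside ∷_))) _ ⟩
  ∑ f + ∑ g ∎
  where open ≡-Reasoning

∑-*ˡ : ∀ {n} c (f : Subset n → ℕ) → ∑ (λ T → c * f T) ≡ c * ∑ f
∑-*ˡ {zero}  c f = refl
∑-*ˡ {suc n} c f = trans (cong₂ _+_ (∑-*ˡ c (f ∘ (inside ∷_))) (∑-*ˡ c (f ∘ (outside ∷_))))
                         (sym (*-distribˡ-+ c _ _))

∑-zero : ∀ {n} → ∑ {n} (λ _ → 0) ≡ 0
∑-zero {n} = ∑-*ˡ 0 (λ (_ : Subset n) → 0)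

∑-*ˡ-assoc : ∀ {n} a (f g : Subset n → ℕ) → ∑ (λ T → a * f T * g T) ≡ a * ∑ (λ T → f T * g T)
∑-*ˡ-assoc a f g = trans (∑-cong (λ T → *-assoc a (f T) (g T))) (∑-*ˡ a (λ T → f T * g T))

∑-*-zeroʳ : ∀ {n} (f : Subset n → ℕ) → ∑ (λ T → f T * 0) ≡ 0
∑-*-zeroʳ {n} f = trans (∑-cong (λ T → *-zeroʳ (f T))) (∑-zero {n})

∑-mono-≤ : ∀ {n} {f g : Subset n → ℕ} → (∀ T → f T ≤ g T) → ∑ f ≤ ∑ g
∑-mono-≤ {zero}  f≤g = f≤g []
∑-mono-≤ {suc n} f≤g = +-mono-≤ (∑-mono-≤ (f≤g ∘ (inside ∷_))) (∑-mono-≤ (f≤g ∘ (outside ∷_)))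

∑-mono-< : ∀ {n} {f g : Subset n → ℕ} → (∀ T → f T ≤ g T) → ∀ T₀ → f T₀ < g T₀ → ∑ f < ∑ g
∑-mono-< {zero}  f≤g []             f<g = f<g
∑-mono-< {suc n} f≤g (inside  ∷ T₀) f<g =
  +-mono-<-≤ (∑-mono-< (f≤g ∘ (inside ∷_)) T₀ f<g) (∑-mono-≤ (f≤g ∘ (outside ∷_)))
∑-mono-< {suc n} f≤g (outside ∷ T₀) f<g =
  +-mono-≤-< (∑-mono-≤ (f≤g ∘ (inside ∷_))) (∑-mono-< (f≤g ∘ (outside ∷_)) T₀ f<g)

χ : Bool → ℕ
χ true  = 1
χ false = 0

weight : ∀ {n} → ℕ → ℕ → Subset n → ℕ
weight u v []            = 1
weight u v (inside  ∷ T) = u * weight u v T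
weight u v (outside ∷ T) = v * weight u v T

weight-positive : ∀ {n u v} → 1 ≤ u → 1 ≤ v → (T : Subset n) → 1 ≤ weight u v T
weight-positive 1≤u 1≤v []            = ≤-refl
weight-positive 1≤u 1≤v (inside  ∷ T) = *-mono-≤ 1≤u (weight-positive 1≤u 1≤v T)
weight-positive 1≤u 1≤v (outside ∷ T) = *-mono-≤ 1≤v (weight-positive 1≤u 1≤v T)

∑-weight : ∀ n u v → ∑ (weight {n} u v) ≡ (u + v) ^ n
∑-weight zero    u v = refl
∑-weight (suc n) u v = begin
  ∑ (λ T → u * ω T) + ∑ (λ T → v * ω T)  ≡⟨ cong₂ _+_ (∑-*ˡ u ω) (∑-*ˡ v ω) ⟩
  u * ∑ ω + v * ∑ ω                      ≡⟨ *-distribʳ-+ (∑ ω) u v ⟨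
  (u + v) * ∑ ω                          ≡⟨ cong ((u + v) *_) (∑-weight n u v) ⟩
  (u + v) ^ suc n                        ∎
  where
  open ≡-Reasoning
  ω : Subset n → ℕ
  ω = weight u v

upWeight : ∀ {n} → ℕ → ℕ → Subset n → ℕ
upWeight u v V = ∑ (λ T → weight u v T * χ (does (V ⊆? T)))

downWeight : ∀ {n} → ℕ → ℕ → Subset n → ℕ
downWeight u v V = ∑ (λ T → weight u v T * χ (does (T ⊆? V)))

private
  pull-factor : ∀ a b {x p q r} → x * p ≡ q * r → a * x * (b * p) ≡ a * q * (b * r)
  pull-factor a b {x} {p} {q} {r} xp≡qr = begin
    a * x * (b * p)  ≡⟨ solve 4 (λ a b x p → a :* x :* (b :* p) := a :* b :* (x :* p)) refl a b x p ⟩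
    a * b * (x * p)  ≡⟨ cong (a * b *_) xp≡qr ⟩
    a * b * (q * r)  ≡⟨ solve 4 (λ a b q r → a :* b :* (q :* r) := a :* q :* (b :* r)) refl a b q r ⟩
    a * q * (b * r)  ∎
    where open ≡-Reasoning

  push-factor : ∀ b {x p q r} → x * p ≡ q * r → b * x * p ≡ q * (b * r)
  push-factor b {x} {p} {q} {r} xp≡qr = begin
    b * x * p    ≡⟨ *-assoc b x p ⟩
    b * (x * p)  ≡⟨ cong (b *_) xp≡qr ⟩
    b * (q * r)  ≡⟨ solve 3 (λ b q r → b :* (q :* r) := q :* (b :* r)) refl b q r ⟩
    q * (b * r)  ∎
    where open ≡-Reasoning

  ∑-split : ∀ {n} a b (f g : Subset n → ℕ) →
    ∑ (λ T → a * f T * g T) + ∑ (λ T → b * f T * g T) ≡ (a + b) * ∑ (λ T → f T * g T)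
  ∑-split a b f g = trans (cong₂ _+_ (∑-*ˡ-assoc a f g) (∑-*ˡ-assoc b f g)) (sym (*-distribʳ-+ _ a b))

  ∑-only-first : ∀ {n} a b (f g : Subset n → ℕ) →
    ∑ (λ T → a * f T * g T) + ∑ (λ T → b * f T * 0) ≡ a * ∑ (λ T → f T * g T)
  ∑-only-first a b f g = trans (cong₂ _+_ (∑-*ˡ-assoc a f g) (∑-*-zeroʳ (λ T → b * f T))) (+-identityʳ _)

  ∑-only-second : ∀ {n} a b (f g : Subset n → ℕ) →
    ∑ (λ T → a * f T * 0) + ∑ (λ T → b * f T * g T) ≡ b * ∑ (λ T → f T * g T)
  ∑-only-second a b f g = cong₂ _+_ (∑-*-zeroʳ (λ T → a * f T)) (∑-*ˡ-assoc b f g)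

upWeight-closed : ∀ {n} u v (V : Subset n) →
  upWeight u v V * (u + v) ^ ∣ V ∣ ≡ u ^ ∣ V ∣ * (u + v) ^ n
upWeight-closed u v []            = refl
upWeight-closed u v (inside  ∷ V) =
  trans (cong (_* (u + v) ^ suc ∣ V ∣) (∑-only-first u v (weight u v) (χ ∘ does ∘ (V ⊆?_))))
        (pull-factor u (u + v) {q = u ^ ∣ V ∣} (upWeight-closed u v V))
upWeight-closed u v (outside ∷ V) =
  trans (cong (_* (u + v) ^ ∣ V ∣) (∑-split u v (weight u v) (χ ∘ does ∘ (V ⊆?_))))
        (push-factor (u + v) {q = u ^ ∣ V ∣} (upWeight-closed u v V))

downWeight-closed : ∀ {n} u v (V : Subset n) →
  downWeight u v V * (u + v) ^ ∣ ∁ V ∣ ≡ v ^ ∣ ∁ V ∣ * (u + v) ^ n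
downWeight-closed u v []            = refl
downWeight-closed u v (inside  ∷ V) =
  trans (cong (_* (u + v) ^ ∣ ∁ V ∣) (∑-split u v (weight u v) (χ ∘ does ∘ (_⊆? V))))
        (push-factor (u + v) {q = v ^ ∣ ∁ V ∣} (downWeight-closed u v V))
downWeight-closed u v (outside ∷ V) =
  trans (cong (_* (u + v) ^ suc ∣ ∁ V ∣) (∑-only-second u v (weight u v) (χ ∘ does ∘ (_⊆? V))))
        (pull-factor v (u + v) {q = v ^ ∣ ∁ V ∣} (downWeight-closed u v V))

private
  closed-form-bound : ∀ c {a k n x y w} .{{_ : NonZero w}} → x * w ^ k ≡ y ^ k * w ^ n →
    y ≤ w → a ≤ k → c * y ^ a ≤ w ^ a → c * x ≤ w ^ n
  closed-form-bound c {a} {k} {n} {x} {y} {w} closed y≤w a≤k cyᵃ≤wᵃ =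
    *-cancelʳ-≤ (c * x) (w ^ n) (w ^ k) {{m^n≢0 w k}} (begin
      c * x * w ^ k        ≡⟨ *-assoc c x (w ^ k) ⟩
      c * (x * w ^ k)      ≡⟨ cong (c *_) closed ⟩
      c * (y ^ k * w ^ n)  ≡⟨ *-assoc c (y ^ k) (w ^ n) ⟨
      c * y ^ k * w ^ n    ≤⟨ *-monoˡ-≤ (w ^ n) (c*u^a≤w^a⇒c*u^b≤w^b c y≤w a≤k cyᵃ≤wᵃ) ⟩
      w ^ k * w ^ n        ≡⟨ *-comm (w ^ k) (w ^ n) ⟩
      w ^ n * w ^ k        ∎)
    where open ≤-Reasoning

upWeight-bound : ∀ {n} c {a} u v .{{_ : NonZero (u + v)}} (V : Subset n) →
  a ≤ ∣ V ∣ → c * u ^ a ≤ (u + v) ^ a → c * upWeight u v V ≤ (u + v) ^ n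
upWeight-bound {n} c u v V = closed-form-bound c {n = n} (upWeight-closed u v V) (m≤m+n u v)

downWeight-bound : ∀ {n} c {b} u v .{{_ : NonZero (u + v)}} (V : Subset n) →
  b ≤ ∣ ∁ V ∣ → c * v ^ b ≤ (u + v) ^ b → c * downWeight u v V ≤ (u + v) ^ n
downWeight-bound {n} c u v V = closed-form-bound c {n = n} (downWeight-closed u v V) (m≤n+m v u)

-- Catching subsets by the members of a family

Catches : ∀ {n} → Subset n → Subset n → Subset n → Set
Catches H V T = (V ∩ H ≡ ⊥ × V ⊆ T) ⊎ (H ⊆ V × T ⊆ V)

catchesIf : ∀ {n a} {A : Set a} → Dec A → Subset n → Subset n → Bool
catchesIf (yes _) V T = does (T ⊆? V)
catchesIf (no  _) V T = does (V ⊆? T)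

-- V is treated as large iff H ⊆ V. Members of 𝒜 are disjoint from H or contain it, and for
-- them this decides Catches H V T (Catches⇒catches).
catches : ∀ {n} → Subset n → Subset n → Subset n → Bool
catches H V T = catchesIf (H ⊆? V) V T

catchWeight : ∀ {n} → ℕ → ℕ → Subset n → Subset n → ℕ
catchWeight u v H V = ∑ (λ T → weight u v T * χ (catches H V T))

catchWeight-bound : ∀ {n} c {a b} u v .{{_ : NonZero (u + v)}} (H V : Subset n) →
  c * u ^ a ≤ (u + v) ^ a → c * v ^ b ≤ (u + v) ^ b →
  (¬ H ⊆ V → a ≤ ∣ V ∣) → (H ⊆ V → b ≤ ∣ ∁ V ∣) → c * catchWeight u v H V ≤ (u + v) ^ n
catchWeight-bound {n} c u v H V cuᵃ≤wᵃ cvᵇ≤wᵇ small large = bound (H ⊆? V)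
  where
  bound : (H⊆?V : Dec (H ⊆ V)) → c * ∑ (λ T → weight u v T * χ (catchesIf H⊆?V V T)) ≤ (u + v) ^ n
  bound (yes H⊆V) = downWeight-bound c u v V (large H⊆V) cvᵇ≤wᵇ
  bound (no  H⊈V) = upWeight-bound c u v V (small H⊈V) cuᵃ≤wᵃ

*-sum-map-≤ : ∀ {a} {A : Set a} c b (f : A → ℕ) xs →
  (∀ {x} → x ∈ xs → c * f x ≤ b) → c * sum (map f xs) ≤ length xs * b
*-sum-map-≤ c b f []       _     = ≤-reflexive (*-zeroʳ c)
*-sum-map-≤ c b f (x ∷ xs) cf≤b = begin
  c * (f x + sum (map f xs))        ≡⟨ *-distribˡ-+ c (f x) _ ⟩
  c * f x + c * sum (map f xs)      ≤⟨ +-mono-≤ (cf≤b (here refl)) (*-sum-map-≤ c b f xs (cf≤b ∘ there)) ⟩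
  b + length xs * b                 ∎
  where open ≤-Reasoning

∈⇒≤sum-map : ∀ {a} {A : Set a} (f : A → ℕ) {x xs} → x ∈ xs → f x ≤ sum (map f xs)
∈⇒≤sum-map f (here refl) = m≤m+n _ _
∈⇒≤sum-map f (there x∈xs) = ≤-trans (∈⇒≤sum-map f x∈xs) (m≤n+m _ _)

multiplicity : ∀ {n} → Subset n → Family n → Subset n → ℕ
multiplicity H 𝒜 T = sum (map (λ V → χ (catches H V T)) 𝒜)

catchTotal : ∀ {n} → ℕ → ℕ → Subset n → Family n → ℕ
catchTotal u v H 𝒜 = sum (map (catchWeight u v H) 𝒜)

∑-weight*multiplicity : ∀ {n} u v (H : Subset n) 𝒜 →
  ∑ (λ T → weight u v T * multiplicity H 𝒜 T) ≡ catchTotal u v H 𝒜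
∑-weight*multiplicity {n} u v H []      = ∑-*-zeroʳ (weight {n} u v)
∑-weight*multiplicity u v H (V ∷ 𝒜) = begin
  ∑ (λ T → weight u v T * (χ (catches H V T) + multiplicity H 𝒜 T))
    ≡⟨ ∑-cong (λ T → *-distribˡ-+ (weight u v T) (χ (catches H V T)) (multiplicity H 𝒜 T)) ⟩
  ∑ (λ T → weight u v T * χ (catches H V T) + weight u v T * multiplicity H 𝒜 T)
    ≡⟨ ∑-+ (λ T → weight u v T * χ (catches H V T)) (λ T → weight u v T * multiplicity H 𝒜 T) ⟩
  catchWeight u v H V + ∑ (λ T → weight u v T * multiplicity H 𝒜 T)
    ≡⟨ cong (catchWeight u v H V +_) (∑-weight*multiplicity u v H 𝒜) ⟩
  catchWeight u v H V + catchTotal u v H 𝒜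
    ∎
  where open ≡-Reasoning

catchTotal-≤ : ∀ {n} c {a b} u v .{{_ : NonZero (u + v)}} (H : Subset n) 𝒜 →
  c * u ^ a ≤ (u + v) ^ a → c * v ^ b ≤ (u + v) ^ b →
  (∀ {V} → V ∈ 𝒜 → ¬ H ⊆ V → a ≤ ∣ V ∣) → (∀ {V} → V ∈ 𝒜 → H ⊆ V → b ≤ ∣ ∁ V ∣) →
  c * catchTotal u v H 𝒜 ≤ length 𝒜 * (u + v) ^ n
catchTotal-≤ c u v H 𝒜 cuᵃ≤wᵃ cvᵇ≤wᵇ small large = *-sum-map-≤ c _ (catchWeight u v H) 𝒜
  (λ V∈𝒜 → catchWeight-bound c u v H _ cuᵃ≤wᵃ cvᵇ≤wᵇ (small V∈𝒜) (large V∈𝒜))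

module _ {n} (u v : ℕ) (H : Subset n) (𝒜 : Family n) (covered : ∀ T → 1 ≤ multiplicity H 𝒜 T) where

  private
    ω : Subset n → ℕ
    ω = weight u v

    ∑-weight*1 : ∑ (λ T → ω T * 1) ≡ (u + v) ^ n
    ∑-weight*1 = trans (∑-cong (λ T → *-identityʳ (ω T))) (∑-weight n u v)

  catchTotal-≥ : (u + v) ^ n ≤ catchTotal u v H 𝒜
  catchTotal-≥ = begin
    (u + v) ^ n                           ≡⟨ ∑-weight*1 ⟨
    ∑ (λ T → ω T * 1)                     ≤⟨ ∑-mono-≤ (λ T → *-monoʳ-≤ (ω T) (covered T)) ⟩
    ∑ (λ T → ω T * multiplicity H 𝒜 T)   ≡⟨ ∑-weight*multiplicity u v H 𝒜 ⟩
    catchTotal u v H 𝒜                    ∎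
    where open ≤-Reasoning

  catchTotal-> : 1 ≤ u → 1 ≤ v → ∀ T₀ → 2 ≤ multiplicity H 𝒜 T₀ → (u + v) ^ n < catchTotal u v H 𝒜
  catchTotal-> 1≤u 1≤v T₀ caught-twice = begin-strict
    (u + v) ^ n                           ≡⟨ ∑-weight*1 ⟨
    ∑ (λ T → ω T * 1)                     <⟨ ∑-mono-< (λ T → *-monoʳ-≤ (ω T) (covered T)) T₀
                                                      (*-monoʳ-< (ω T₀) caught-twice) ⟩
    ∑ (λ T → ω T * multiplicity H 𝒜 T)   ≡⟨ ∑-weight*multiplicity u v H 𝒜 ⟩
    catchTotal u v H 𝒜                    ∎
    where
    open ≤-Reasoning
    instance
      ωT₀≢0 : NonZero (ω T₀)
      ωT₀≢0 = >-nonZero (weight-positive 1≤u 1≤v T₀)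

catches-⊤⊎⊥ : ∀ {n} (H V : Subset n) → 1 ≤ χ (catches H V ⊤) + χ (catches H V ⊥)
catches-⊤⊎⊥ H V = caught (H ⊆? V)
  where
  caught : (H⊆?V : Dec (H ⊆ V)) → 1 ≤ χ (catchesIf H⊆?V V ⊤) + χ (catchesIf H⊆?V V ⊥)
  caught (yes _) rewrite dec-true (⊥ ⊆? V) (⊆-min V) = m≤n+m 1 _
  caught (no  _) rewrite dec-true (V ⊆? ⊤) (⊆-max V) = m≤m+n 1 _

length≤multiplicity-⊤+⊥ : ∀ {n} (H : Subset n) 𝒜 →
  length 𝒜 ≤ multiplicity H 𝒜 ⊤ + multiplicity H 𝒜 ⊥
length≤multiplicity-⊤+⊥ H []      = z≤n
length≤multiplicity-⊤+⊥ H (V ∷ 𝒜) = ≤-trans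
  (+-mono-≤ (catches-⊤⊎⊥ H V) (length≤multiplicity-⊤+⊥ H 𝒜))
  (≤-reflexive (+-interchange (χ (catches H V ⊤)) (χ (catches H V ⊥)) _ _))

multiplicity-twice : ∀ {n} (H : Subset n) 𝒜 → 3 ≤ length 𝒜 → ∃[ T₀ ] 2 ≤ multiplicity H 𝒜 T₀
multiplicity-twice H 𝒜 3≤N with 3≤m+n⇒2≤m⊎2≤n _ _ (≤-trans 3≤N (length≤multiplicity-⊤+⊥ H 𝒜))
... | inj₁ twice-⊤ = ⊤ , twice-⊤
... | inj₂ twice-⊥ = ⊥ , twice-⊥

-- Saturated families

0<∣p∣⇒Nonempty : ∀ {n} (p : Subset n) → 0 < ∣ p ∣ → Nonempty p
0<∣p∣⇒Nonempty (inside  ∷ p) _      = zero , hereᵥ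
0<∣p∣⇒Nonempty (outside ∷ p) 0<∣p∣ with 0<∣p∣⇒Nonempty p 0<∣p∣
... | x , x∈p = suc x , thereᵥ x∈p

p∩q≡⊥⇒x∈p⇒x∉q : ∀ {n} {p q : Subset n} {x} → p ∩ q ≡ ⊥ → x ∈ₛ p → x ∉ₛ q
p∩q≡⊥⇒x∈p⇒x∉q p∩q≡⊥ x∈p x∈q = ∉⊥ (subst (_ ∈ₛ_) p∩q≡⊥ (x∈p∩q⁺ (x∈p , x∈q)))

p∩q≡q⇒q⊆p : ∀ {n} {p q : Subset n} → p ∩ q ≡ q → q ⊆ p
p∩q≡q⇒q⊆p {p = p} {q} p∩q≡q x∈q = p∩q⊆p p q (subst (_ ∈ₛ_) (sym p∩q≡q) x∈q)

∣p∣+m≤n⇒m≤∣∁p∣ : ∀ {n m} (p : Subset n) → ∣ p ∣ + m ≤ n → m ≤ ∣ ∁ p ∣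
∣p∣+m≤n⇒m≤∣∁p∣ {n} {m} p ∣p∣+m≤n =
  subst (m ≤_) (sym (∣∁p∣≡n∸∣p∣ p)) (m+n≤o⇒m≤o∸n m (subst (_≤ n) (+-comm ∣ p ∣ m) ∣p∣+m≤n))

splits⇒disjoint⊎⊇ : ∀ {n} {𝒜 : Family n} {X S} → Splits 𝒜 X → S ∈ 𝒜 → S ∩ X ≡ ⊥ ⊎ X ⊆ S
splits⇒disjoint⊎⊇ splits S∈𝒜 with splits S∈𝒜
... | inj₁ S∩X≡⊥ = inj₁ S∩X≡⊥
... | inj₂ S∩X≡X = inj₂ (p∩q≡q⇒q⊆p S∩X≡X)

Catches⇒catches : ∀ {n} {H V T : Subset n} → Nonempty H → Catches H V T → catches H V T ≡ true
Catches⇒catches {H = H} {V} {T} (x , x∈H) = decided (H ⊆? V)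
  where
  decided : (H⊆?V : Dec (H ⊆ V)) → Catches H V T → catchesIf H⊆?V V T ≡ true
  decided (yes _)   (inj₂ (_ , T⊆V))     = dec-true (T ⊆? V) T⊆V
  decided (yes H⊆V) (inj₁ (V∩H≡⊥ , _))   = contradiction x∈H (p∩q≡⊥⇒x∈p⇒x∉q V∩H≡⊥ (H⊆V x∈H))
  decided (no  _)   (inj₁ (_ , V⊆T))     = dec-true (V ⊆? T) V⊆T
  decided (no  H⊈V) (inj₂ (H⊆V , _))     = ⊥-elim (H⊈V H⊆V)

module _ {n} {𝒜 : Family n} {H : Subset n} (splits : Splits 𝒜 H) (2≤∣H∣ : 2 ≤ ∣ H ∣)
         {x} (x∈H : x ∈ₛ H) (T : Subset n) where

  private
    U : Subset n
    U = (T ∩ ∁ H) ∪ ⁅ x ⁆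

    x∈U : x ∈ₛ U
    x∈U = x∈p∪q⁺ (inj₂ (x∈⁅x⁆ x))

    ∈U⇒∈T∖H⊎≡x : ∀ {y} → y ∈ₛ U → (y ∈ₛ T × y ∉ₛ H) ⊎ y ≡ x
    ∈U⇒∈T∖H⊎≡x y∈U with x∈p∪q⁻ (T ∩ ∁ H) ⁅ x ⁆ y∈U
    ... | inj₂ y∈⁅x⁆     = inj₂ (x∈⁅y⁆⇒x≡y x y∈⁅x⁆)
    ... | inj₁ y∈T∩∁H with x∈p∩q⁻ T (∁ H) y∈T∩∁H
    ...   | y∈T , y∈∁H = inj₁ (y∈T , x∈∁p⇒x∉p y∈∁H)

    H⊈U : ¬ H ⊆ U
    H⊈U H⊆U = <⇒≱ 2≤∣H∣ (subst (∣ H ∣ ≤_) (∣⁅x⁆∣≡1 x) (p⊆q⇒∣p∣≤∣q∣ H⊆⁅x⁆))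
      where
      H⊆⁅x⁆ : H ⊆ ⁅ x ⁆
      H⊆⁅x⁆ y∈H with ∈U⇒∈T∖H⊎≡x (H⊆U y∈H)
      ... | inj₁ (_ , y∉H) = contradiction y∈H y∉H
      ... | inj₂ refl      = x∈⁅x⁆ x

    U∉𝒜 : U ∉ 𝒜
    U∉𝒜 U∈𝒜 with splits⇒disjoint⊎⊇ splits U∈𝒜
    ... | inj₁ U∩H≡⊥ = p∩q≡⊥⇒x∈p⇒x∉q U∩H≡⊥ x∈U x∈H
    ... | inj₂ H⊆U   = H⊈U H⊆U

    below-U : ∀ {V} → V ∈ 𝒜 → V ⊆ U → Catches H V T
    below-U V∈𝒜 V⊆U with splits⇒disjoint⊎⊇ splits V∈𝒜
    ... | inj₂ H⊆V   = ⊥-elim (H⊈U (λ y∈H → V⊆U (H⊆V y∈H)))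
    ... | inj₁ V∩H≡⊥ = inj₁ (V∩H≡⊥ , V⊆T)
      where
      V⊆T : _ ⊆ T
      V⊆T y∈V with ∈U⇒∈T∖H⊎≡x (V⊆U y∈V)
      ... | inj₁ (y∈T , _) = y∈T
      ... | inj₂ refl      = contradiction x∈H (p∩q≡⊥⇒x∈p⇒x∉q V∩H≡⊥ y∈V)

    above-U : ∀ {V} → V ∈ 𝒜 → U ⊆ V → Catches H V T
    above-U V∈𝒜 U⊆V with splits⇒disjoint⊎⊇ splits V∈𝒜
    ... | inj₁ V∩H≡⊥ = contradiction x∈H (p∩q≡⊥⇒x∈p⇒x∉q V∩H≡⊥ (U⊆V x∈U))
    ... | inj₂ H⊆V   = inj₂ (H⊆V , T⊆V)
      where
      T⊆V : T ⊆ _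
      T⊆V {y} y∈T with y ∈? H
      ... | yes y∈H = H⊆V y∈H
      ... | no  y∉H = U⊆V (x∈p∪q⁺ (inj₁ (x∈p∩q⁺ (y∈T , x∉p⇒x∈∁p y∉H))))

  saturated⇒caught : IsSaturated 𝒜 → ∃[ V ] V ∈ 𝒜 × Catches H V T
  saturated⇒caught saturated with saturated U U∉𝒜
  ... | V , V∈𝒜 , inj₁ V⊆U = V , V∈𝒜 , below-U V∈𝒜 V⊆U
  ... | V , V∈𝒜 , inj₂ U⊆V = V , V∈𝒜 , above-U V∈𝒜 U⊆V

saturated⇒covered : ∀ {n} {𝒜 : Family n} {H} → IsSaturated 𝒜 → Splits 𝒜 H → 2 ≤ ∣ H ∣ →
  ∀ T → 1 ≤ multiplicity H 𝒜 T
saturated⇒covered {𝒜 = 𝒜} {H} saturated splits 2≤∣H∣ T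
  with 0<∣p∣⇒Nonempty H (≤-trans (s≤s z≤n) 2≤∣H∣)
... | x , x∈H with saturated⇒caught splits 2≤∣H∣ x∈H T saturated
...   | V , V∈𝒜 , caught =
  subst (λ b → χ b ≤ multiplicity H 𝒜 T) (Catches⇒catches (x , x∈H) caught)
        (∈⇒≤sum-map (λ V → χ (catches H V T)) V∈𝒜)

saturated-size-bound : ∀ {n i j} (H : Subset n) (𝒜 : Family n) → 2 ≤ i → i ≤ j →
  IsSaturated 𝒜 → Splits 𝒜 H → 2 ≤ ∣ H ∣ →
  (∀ {S} → S ∈ 𝒜 → S ∩ H ≡ ⊥ → i ≤ ∣ S ∣) → (∀ {L} → L ∈ 𝒜 → H ⊆ L → j ≤ ∣ ∁ L ∣) →
  4 ^ (i * j) < length 𝒜 ^ (i + j)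
saturated-size-bound {n} {i} {j} H 𝒜 2≤i i≤j saturated splits 2≤∣H∣ small large = ≰⇒> Nⁱ⁺ʲ≰4ⁱʲ
  where
  N : ℕ
  N = length 𝒜

  covered : ∀ T → 1 ≤ multiplicity H 𝒜 T
  covered = saturated⇒covered saturated splits 2≤∣H∣

  small′ : ∀ {V} → V ∈ 𝒜 → ¬ H ⊆ V → i ≤ ∣ V ∣
  small′ V∈𝒜 H⊈V with splits⇒disjoint⊎⊇ splits V∈𝒜
  ... | inj₁ V∩H≡⊥ = small V∈𝒜 V∩H≡⊥
  ... | inj₂ H⊆V   = ⊥-elim (H⊈V H⊆V)

  4≤N : 4 ≤ N
  4≤N = *-cancelʳ-≤ 4 N (2 ^ n) {{m^n≢0 2 n}} (begin
    4 * 2 ^ n               ≤⟨ *-monoʳ-≤ 4 (catchTotal-≥ 1 1 H 𝒜 covered) ⟩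
    4 * catchTotal 1 1 H 𝒜  ≤⟨ catchTotal-≤ 4 1 1 H 𝒜 ≤-refl ≤-refl
                                 (λ V∈𝒜 → ≤-trans 2≤i ∘ small′ V∈𝒜)
                                 (λ V∈𝒜 → ≤-trans (≤-trans 2≤i i≤j) ∘ large V∈𝒜) ⟩
    N * 2 ^ n               ∎)
    where open ≤-Reasoning

  Nⁱ⁺ʲ≰4ⁱʲ : ¬ N ^ (i + j) ≤ 4 ^ (i * j)
  Nⁱ⁺ʲ≰4ⁱʲ Nⁱ⁺ʲ≤4ⁱʲ with admissible-weights (≤-trans (n≤1+n 1) 2≤i) i≤j Nⁱ⁺ʲ≤4ⁱʲ
                      | multiplicity-twice H 𝒜 (≤-trans (n≤1+n 3) 4≤N)
  ... | u , v , 1≤u , 1≤v , Nuⁱ≤wⁱ , Nvʲ≤wʲ | T₀ , caught-twice =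
    <⇒≱ (*-monoʳ-< N (catchTotal-> u v H 𝒜 covered 1≤u 1≤v T₀ caught-twice))
        (catchTotal-≤ N u v H 𝒜 Nuⁱ≤wⁱ Nvʲ≤wʲ small′ large)
    where
    instance
      N≢0 : NonZero N
      N≢0 = >-nonZero (≤-trans (s≤s z≤n) 4≤N)
      u+v≢0 : NonZero (u + v)
      u+v≢0 = >-nonZero (≤-trans 1≤u (m≤m+n u v))

lemma17 : ∀ (k i n : ℕ) → 7 ≤ k → 2 ≤ i → i ≤ (k ∸ 1) / 2 →
    (H : Subset n) (𝒜 : Family n) →
    SaturatedAntichain 𝒜 → IsAtom 𝒜 H → 2 ≤ ∣ H ∣ →
    (∀ {S} → S ∈ 𝒜 → S ∩ H ≡ ⊥ → i ≤ ∣ S ∣) →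
    (∀ {L} → L ∈ 𝒜 → H ⊆ L → ∣ L ∣ + (k ∸ i ∸ 1) ≤ n) →
    2 ^ (2 * i * (k ∸ i ∸ 1)) < length 𝒜 ^ (k ∸ 1)
lemma17 k i n _ 2≤i i≤[k∸1]/2 H 𝒜 (_ , _ , saturated) (splits , _) 2≤∣H∣ small large =
  subst₂ (λ a b → a < length 𝒜 ^ b) 4ⁱʲ≡2²ⁱʲ (i≤k∸1⇒i+[k∸i∸1]≡k∸1 k (m+n≤o⇒m≤o i i+i≤k∸1))
    (saturated-size-bound H 𝒜 2≤i (i+i≤k∸1⇒i≤k∸i∸1 k i+i≤k∸1) saturated splits 2≤∣H∣ small
      (λ {L} L∈𝒜 H⊆L → ∣p∣+m≤n⇒m≤∣∁p∣ L (large L∈𝒜 H⊆L)))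
  where
  i+i≤k∸1 : i + i ≤ k ∸ 1
  i+i≤k∸1 = i≤[k∸1]/2⇒i+i≤k∸1 k i≤[k∸1]/2
  4ⁱʲ≡2²ⁱʲ : 4 ^ (i * (k ∸ i ∸ 1)) ≡ 2 ^ (2 * i * (k ∸ i ∸ 1))
  4ⁱʲ≡2²ⁱʲ = trans (^-*-assoc 2 2 (i * (k ∸ i ∸ 1))) (cong (2 ^_) (sym (*-assoc 2 i (k ∸ i ∸ 1))))
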